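{- Let $l:K\to L$ be an injective graph morphism and $f_1:L\to L_1$ a graph morphism which is conflict-free with respect to $l$. Let $(K_1,l_1,g_1)$, with $l_1:K_1\to L_1$ and $g_1:K\to K_1$, be the final pullback complement of $l$ and $f_1$ in the category of graphs. Let $f_2:L_1\to L_2$ be a graph morphism which is conflict-free with respect to $l_1$. Then $f_2\circ f_1$ is conflict-free with respect to $l$.
   Context: Graphs: a set of nodes, a set of edges, source and target functions; graph morphisms preserve sources and targets. Given $l:K\to L$, a morphism $f:L\to L_1$ is conflict-free with respect to $l$ if there are no items (nodes or edges) $x\in l(K)$ and $y\notin l(K)$ of $L$ with $f(x)=f(y)$. A final pullback complement of $l:K\to L$ and $f:L\to L_1$ is a pair $(g:K\to K_1,\ l_1:K_1\to L_1)$ such that $l_1\circ g=f\circ l$ and this square is a pullback, and such that for every pullback square $l'\circ g'=f\circ m$ (with $m:K'\to L$, $g':K'\to K'_1$, $l':K'_1\to L_1$) and every $h:K'\to K$ with $l\circ h=m$, there is a unique $k:K'_1\to K_1$ with $l_1\circ k=l'$ and $k\circ g'=g\circ h$. It is known that for injective $l$ and $f$ conflict-free with respect to $l$, the final pullback complement exists in the category of graphs and $l_1$ is injective. -}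

module Defs where

open import Data.Product using (Σ; _×_; _,_; ∃)
open import Relation.Binary.PropositionalEquality using (_≡_; trans; cong)
open import Relation.Nullary using (¬_)
open import Function.Definitions using (Injective)

record Graph : Set₁ where
  field
    V   : Set
    E   : Set
    src : E → V
    tgt : E → V
open Graph public

record Hom (G H : Graph) : Set where
  field
    hV   : V G → V H
    hE   : E G → E H
    hsrc : ∀ e → hV (src G e) ≡ src H (hE e)
    htgt : ∀ e → hV (tgt G e) ≡ tgt H (hE e)
open Hom public

infixr 9 _∘ᴴ_
_∘ᴴ_ : {A B C : Graph} → Hom B C → Hom A B → Hom A C
hV   (g ∘ᴴ f) v = hV g (hV f v)
hE   (g ∘ᴴ f) e = hE g (hE f e)
hsrc (g ∘ᴴ f) e = trans (cong (hV g) (hsrc f e)) (hsrc g (hE f e))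
htgt (g ∘ᴴ f) e = trans (cong (hV g) (htgt f e)) (htgt g (hE f e))

infix 4 _≈ᴴ_
_≈ᴴ_ : {A B : Graph} → Hom A B → Hom A B → Set
f ≈ᴴ g = (∀ v → hV f v ≡ hV g v) × (∀ e → hE f e ≡ hE g e)

InjectiveHom : {A B : Graph} → Hom A B → Set
InjectiveHom {A} {B} f = Injective _≡_ _≡_ (hV f) × Injective _≡_ _≡_ (hE f)

ConflictFree : {K L L₁ : Graph} → Hom K L → Hom L L₁ → Set
ConflictFree {K} {L} l f =
    (¬ Σ (V K) λ k → Σ (V L) λ y →
         (¬ ∃ λ k' → hV l k' ≡ y) × (hV f (hV l k) ≡ hV f y))
  × (¬ Σ (E K) λ k → Σ (E L) λ y →
         (¬ ∃ λ k' → hE l k' ≡ y) × (hE f (hE l k) ≡ hE f y))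

IsPullback : {K K₁ L L₁ : Graph} →
             (g : Hom K K₁) (l : Hom K L) (l₁ : Hom K₁ L₁) (f : Hom L L₁) → Set₁
IsPullback {K} {K₁} {L} {L₁} g l l₁ f =
    (l₁ ∘ᴴ g ≈ᴴ f ∘ᴴ l)
  × (∀ (P : Graph) (a : Hom P K₁) (b : Hom P L) → l₁ ∘ᴴ a ≈ᴴ f ∘ᴴ b →
       Σ (Hom P K) λ u → (g ∘ᴴ u ≈ᴴ a) × (l ∘ᴴ u ≈ᴴ b)
         × (∀ (u' : Hom P K) → g ∘ᴴ u' ≈ᴴ a → l ∘ᴴ u' ≈ᴴ b → u' ≈ᴴ u))

IsFPC : {K L L₁ K₁ : Graph} →
        (l : Hom K L) (f : Hom L L₁) (g : Hom K K₁) (l₁ : Hom K₁ L₁) → Set₁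
IsFPC {K} {L} {L₁} {K₁} l f g l₁ =
    IsPullback g l l₁ f
  × (∀ (K' K'₁ : Graph) (m : Hom K' L) (g' : Hom K' K'₁) (l' : Hom K'₁ L₁) →
       IsPullback g' m l' f →
       (h : Hom K' K) → l ∘ᴴ h ≈ᴴ m →
       Σ (Hom K'₁ K₁) λ k → (l₁ ∘ᴴ k ≈ᴴ l') × (k ∘ᴴ g' ≈ᴴ g ∘ᴴ h)
         × (∀ (k' : Hom K'₁ K₁) → l₁ ∘ᴴ k' ≈ᴴ l' → k' ∘ᴴ g' ≈ᴴ g ∘ᴴ h → k' ≈ᴴ k))

-- A
-- pullback square l₁ ∘ g₁ = f₁ ∘ l reflects images: if f₁ y lies in the image
-- of l₁, then y lies in the image of l (apply the universal property to the
-- one-node, resp. one-edge, graph). So a conflict l k ≠ y of f₂ ∘ f₁ yields the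
-- conflict l₁ (g₁ k) ≠ f₁ y of f₂.
module Submission where

open import Defs
open import Data.Bool using (Bool; true; false)
open import Data.Empty using (⊥)
open import Data.Product using (_×_; _,_; ∃; proj₂)
open import Data.Unit using (⊤; tt)
open import Relation.Binary.PropositionalEquality using (_≡_; refl; sym; trans; cong)

pointGraph : Graph
pointGraph = record { V = ⊤ ; E = ⊥ ; src = λ () ; tgt = λ () }

edgeGraph : Graph
edgeGraph = record { V = Bool ; E = ⊤ ; src = λ _ → false ; tgt = λ _ → true }

nodeAt : (G : Graph) → V G → Hom pointGraph G
nodeAt G v = record { hV = λ _ → v ; hE = λ () ; hsrc = λ () ; htgt = λ () }

edgeAt : (G : Graph) → E G → Hom edgeGraph G
edgeAt G e = record
  { hV   = λ { false → src G e ; true → tgt G e }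
  ; hE   = λ _ → e
  ; hsrc = λ _ → refl
  ; htgt = λ _ → refl
  }

module _ {G G′ H : Graph} (a : Hom G H) (b : Hom G′ H) where

  nodeAt-≈ᴴ : ∀ {v w} → hV a v ≡ hV b w → a ∘ᴴ nodeAt G v ≈ᴴ b ∘ᴴ nodeAt G′ w
  nodeAt-≈ᴴ p = (λ _ → p) , λ ()

  edgeAt-≈ᴴ : ∀ {e e′} → hE a e ≡ hE b e′ → a ∘ᴴ edgeAt G e ≈ᴴ b ∘ᴴ edgeAt G′ e′
  edgeAt-≈ᴴ {e} {e′} p = endpoints , λ _ → p
    where
    endpoints : ∀ i → hV (a ∘ᴴ edgeAt G e) i ≡ hV (b ∘ᴴ edgeAt G′ e′) i
    endpoints false = trans (hsrc a e) (trans (cong (src H) p) (sym (hsrc b e′)))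
    endpoints true  = trans (htgt a e) (trans (cong (tgt H) p) (sym (htgt b e′)))

module _ {K K₁ L L₁ : Graph} (g : Hom K K₁) (l : Hom K L) (l₁ : Hom K₁ L₁) (f : Hom L L₁)
         (pb : IsPullback g l l₁ f) where

  pullback-reflects-nodeImage : ∀ {k₁ y} → hV l₁ k₁ ≡ hV f y → ∃ λ k → hV l k ≡ y
  pullback-reflects-nodeImage {k₁} {y} p =
    let (u , _ , (lu≈ , _) , _) = proj₂ pb pointGraph (nodeAt K₁ k₁) (nodeAt L y) (nodeAt-≈ᴴ l₁ f p)
    in  hV u tt , lu≈ tt

  pullback-reflects-edgeImage : ∀ {k₁ y} → hE l₁ k₁ ≡ hE f y → ∃ λ k → hE l k ≡ y
  pullback-reflects-edgeImage {k₁} {y} p =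
    let (u , _ , (_ , lu≈) , _) = proj₂ pb edgeGraph (edgeAt K₁ k₁) (edgeAt L y) (edgeAt-≈ᴴ l₁ f p)
    in  hE u tt , lu≈ tt

pullback-conflictFree-∘ᴴ : {K K₁ L L₁ L₂ : Graph}
  (g : Hom K K₁) (l : Hom K L) (l₁ : Hom K₁ L₁) (f₁ : Hom L L₁) (f₂ : Hom L₁ L₂) →
  IsPullback g l l₁ f₁ → ConflictFree l₁ f₂ → ConflictFree l (f₂ ∘ᴴ f₁)
pullback-conflictFree-∘ᴴ g l l₁ f₁ f₂ pb@((commV , commE) , _) (cfV , cfE) =
    (λ (k , y , y∉l , eq) →
       cfV ( hV g k , hV f₁ y
           , (λ (_ , p) → y∉l (pullback-reflects-nodeImage g l l₁ f₁ pb p))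
           , trans (cong (hV f₂) (commV k)) eq ))
  , (λ (k , y , y∉l , eq) →
       cfE ( hE g k , hE f₁ y
           , (λ (_ , p) → y∉l (pullback-reflects-edgeImage g l l₁ f₁ pb p))
           , trans (cong (hE f₂) (commE k)) eq ))

lemma3p10 : {K L L₁ L₂ K₁ : Graph}
    (l : Hom K L) → InjectiveHom l →
    (f₁ : Hom L L₁) → ConflictFree l f₁ →
    (g₁ : Hom K K₁) (l₁ : Hom K₁ L₁) → IsFPC l f₁ g₁ l₁ →
    (f₂ : Hom L₁ L₂) → ConflictFree l₁ f₂ →
    ConflictFree l (f₂ ∘ᴴ f₁)
lemma3p10 l _ f₁ _ g₁ l₁ (pullback , _) f₂ = pullback-conflictFree-∘ᴴ g₁ l l₁ f₁ f₂ pullback
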